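{- Let $\mathcal{P}=(X,\prec)$ be a poset with $|X|=n$. Let $M$ be a maximum matching of the comparability graph $\mathcal{C}(\mathcal{P})$, let $W$ be the set of vertices covered by $M$, and let $A=X\setminus W$. Let $A_1,\dots,A_\ell$ be the equivalence classes of $A$ under $x\sim y\iff N(x)=N(y)$, and let $a_i=|A_i|$. Define the poset $\mathcal{P}'=(X',\prec')$ with $X'=W\cup Q$, where $Q=\{x_i^k: i\in[\ell],\,k\in[a_i]\}$ is a set of new (virtual) elements, and for $x,y\in X'$: (a) if $x,y\in W$: $x\prec' y\iff x\prec y$; (b) if $x=x_i^p$, $y=x_j^q$: $x\prec' y\iff i=j$ and $p<q$; (c) if $x\in W$, $y=x_i^p$: $x\prec' y\iff x\prec z$ for some $z\in A_i$; (d) if $x=x_i^p$, $y\in W$: $x\prec' y\iff z\prec y$ for some $z\in A_i$. Then $\mathrm{LE}(\mathcal{P})=\mathrm{LE}(\mathcal{P}')\cdot\prod_{i\in[\ell]}(a_i!)$.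
   Context: A poset $\mathcal{P}=(X,\prec)$ has a finite ground set $X$ and an irreflexive, transitive relation $\prec$. A linear extension is a total order on the ground set containing the order relation; $\mathrm{LE}(\cdot)$ denotes the number of linear extensions. $[k]=\{1,\dots,k\}$. The comparability graph $\mathcal{C}(\mathcal{P})$ has vertex set $X$ and edges $\{x,y\}$ whenever $x\prec y$ or $y\prec x$; $N(x)$ is the set of elements of $X$ comparable with $x$. (By maximality of $M$, $A$ is an antichain.) -}

module Defs where

open import Level using (0ℓ)
open import Data.Nat using (ℕ; zero; suc; _*_; _≤_; _!)

open import Data.Fin using (Fin; _<_)
open import Data.Fin.Properties using (_≟_; all?; any?)
import Data.Fin.Properties as FinP
open import Data.Bool using (Bool; true; false)
open import Data.Vec using (Vec; []; _∷_; lookup)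
open import Data.List using (List; []; _∷_; [_]; map; concatMap; filter; length; allFin; foldr)
open import Data.List.Relation.Unary.Unique.Propositional using (Unique)
open import Data.List.Membership.Propositional using (_∈_)
open import Data.Product using (Σ; ∃; _×_; _,_; proj₁; proj₂)
open import Data.Sum using (_⊎_)
open import Data.Empty using (⊥)
open import Data.Unit using (⊤)
open import Relation.Nullary using (¬_; Dec; yes; no)
open import Relation.Nullary.Decidable using (_×-dec_; _⊎-dec_; _→-dec_; isYes)
open import Relation.Binary using (Rel; Decidable; Transitive)
open import Relation.Binary.PropositionalEquality using (_≡_)

record Poset (n : ℕ) : Set₁ where
  field
    _≺_     : Rel (Fin n) 0ℓ
    _≺?_    : Decidable _≺_
    irrefl  : ∀ x → ¬ (x ≺ x)
    trans   : Transitive _≺_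

-- A linear extension is a listing v of the ground set (an injective
-- vector of length n, i.e. a total order: v i comes before v j iff i < j)
-- containing the relation: v i R v j implies i < j.

IsLinExt : ∀ {n} → Rel (Fin n) 0ℓ → Vec (Fin n) n → Set
IsLinExt {n} R v =
  (∀ (i j : Fin n) → lookup v i ≡ lookup v j → i ≡ j) ×
  (∀ (i j : Fin n) → R (lookup v i) (lookup v j) → i < j)

isLinExt? : ∀ {n} (R : Rel (Fin n) 0ℓ) → Decidable R →
            (v : Vec (Fin n) n) → Dec (IsLinExt R v)
isLinExt? R R? v =
  all? (λ i → all? (λ j → (lookup v i ≟ lookup v j) →-dec (i ≟ j)))
  ×-dec
  all? (λ i → all? (λ j → R? (lookup v i) (lookup v j) →-dec (i FinP.<? j)))

allVecs : (m k : ℕ) → List (Vec (Fin m) k)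
allVecs m zero    = [ [] ]
allVecs m (suc k) = concatMap (λ x → map (x ∷_) (allVecs m k)) (allFin m)

LE-rel : ∀ {n} (R : Rel (Fin n) 0ℓ) → Decidable R → ℕ
LE-rel {n} R R? = length (filter (isLinExt? R R?) (allVecs n n))

LE : ∀ {n} → Poset n → ℕ
LE P = LE-rel (Poset._≺_ P) (Poset._≺?_ P)

module _ {n : ℕ} (P : Poset n) where
  open Poset P
  open import Data.List.Membership.DecPropositional (_≟_ {n = n}) using (_∈?_)

  Comparable : Fin n → Fin n → Set
  Comparable x y = x ≺ y ⊎ y ≺ x

  comparable? : Decidable Comparable
  comparable? x y = (x ≺? y) ⊎-dec (y ≺? x)

  endpoints : List (Fin n × Fin n) → List (Fin n)
  endpoints = concatMap (λ e → proj₁ e ∷ proj₂ e ∷ [])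

  IsMatching : List (Fin n × Fin n) → Set
  IsMatching M = (∀ {e} → e ∈ M → Comparable (proj₁ e) (proj₂ e))
                 × Unique (endpoints M)

  IsMaximumMatching : List (Fin n × Fin n) → Set
  IsMaximumMatching M = IsMatching M
                        × (∀ M′ → IsMatching M′ → length M′ ≤ length M)

  SameN : Fin n → Fin n → Set
  SameN x y = ∀ z → (Comparable x z → Comparable y z)
                  × (Comparable y z → Comparable x z)

  sameN? : Decidable SameN
  sameN? x y = all? (λ z → (comparable? x z →-dec comparable? y z)
                       ×-dec (comparable? y z →-dec comparable? x z))

  module Construction (M : List (Fin n × Fin n)) where

    InW : Fin n → Set
    InW x = x ∈ endpoints M

    InA : Fin n → Set
    InA x = ¬ InW x

    inA? : (x : Fin n) → Dec (InA x)
    inA? x with x ∈? endpoints M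
    ... | yes p = no (λ q → q p)
    ... | no ¬p = yes ¬p

    -- X' = W ∪ Q with |Q| = |A|; we represent
    -- the virtual element x_i^k by the k-th smallest element (in the
    -- order of Fin n) of the class A_i.  Hence X' is again Fin n, the
    -- elements of W represent themselves, and for u, v ∈ A:
    --   "u = x_i^p, v = x_j^q with i = j and p < q"  iff
    --   "u ~ v (N(u) = N(v)) and u < v in Fin n".
    -- In (c),(d) "z ∈ A_i" for the class of the virtual element u
    -- becomes "z ∈ A with N(z) = N(u)".

    Rel′ : Bool → Bool → Fin n → Fin n → Set
    Rel′ false false x y = x ≺ y
    Rel′ true  true  x y = SameN x y × x < y
    Rel′ false true  x y = ∃ λ z → InA z × SameN z y × x ≺ z
    Rel′ true  false x y = ∃ λ z → InA z × SameN z x × z ≺ y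

    rel′? : ∀ b c → Decidable (Rel′ b c)
    rel′? false false x y = x ≺? y
    rel′? true  true  x y = sameN? x y ×-dec (x FinP.<? y)
    rel′? false true  x y = any? (λ z → inA? z ×-dec (sameN? z y ×-dec (x ≺? z)))
    rel′? true  false x y = any? (λ z → inA? z ×-dec (sameN? z x ×-dec (z ≺? y)))

    _≺′_ : Rel (Fin n) 0ℓ
    x ≺′ y = Rel′ (isYes (inA? x)) (isYes (inA? y)) x y

    _≺′?_ : Decidable _≺′_
    x ≺′? y = rel′? (isYes (inA? x)) (isYes (inA? y)) x y

    LE′ : ℕ
    LE′ = LE-rel _≺′_ _≺′?_

    -- ∏_{i ∈ [ℓ]} a_i!  : each class A_i is represented by its least
    -- element (in Fin n); a_i = |A_i| = #{ y ∈ A : N(y) = N(x) }.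

    IsRep : Fin n → Set
    IsRep x = InA x × (∀ y → InA y → SameN y x → x Data.Fin.≤ y)

    isRep? : (x : Fin n) → Dec (IsRep x)
    isRep? x = inA? x ×-dec all? (λ y → inA? y →-dec (sameN? y x →-dec (x FinP.≤? y)))

    classSize : Fin n → ℕ
    classSize x = length (filter (λ y → inA? y ×-dec sameN? y x) (allFin n))

    prodFact : ℕ
    prodFact = foldr (λ x r → (classSize x) ! * r) 1 (filter isRep? (allFin n))

-- Elements of one class A_i are incomparable and have the same predecessors
-- and the same successors, so transposing two of them preserves ≺.  Hence the
-- first element of A_i in a linear extension is equidistributed over A_i:
-- LE(R) = |A_i| · LE(R + "t precedes the rest of A_i"), and iterating,
-- LE(R) = a_i! · LE(R + a fixed chain on A_i).  After adding such a chain on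
-- every class we get ≺′: on W nothing changes, between W and A_i the relation
-- is the one shared by all of A_i, and inside A, an antichain by maximality of
-- M, only the added chains remain.
module Submission where

open import Level using (0ℓ)
open import Function using (_∘_)
open import Data.Nat as ℕ using (ℕ; zero; suc; _+_; _*_; _!; z≤n; s≤s)
import Data.Nat.Properties as ℕ
open import Data.Fin using (Fin; zero; suc; _<_; _≤_; punchOut)
open import Data.Fin.Properties
  using (_≟_; any?; pigeonhole; punchOut-injective; <⇒≢; ≤∧≢⇒<; <-asym; <-irrefl; ≤-antisym)
import Data.Fin.Properties as Fin
open import Data.Fin.Permutation.Components using (transpose; transpose-inverse)
open import Data.Vec as Vec using (Vec; []; _∷_; lookup)
open import Data.Vec.Properties using (lookup-map; ∷-injective)
open import Data.List
  using (List; []; _∷_; _++_; map; length; filter; foldr; allFin; concatMap; cartesianProductWith)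
open import Data.List.Properties using (filter-≐; filter-none; length-++; length-map)
open import Data.List.Membership.Propositional using (_∈_; _∉_; find; lose)
open import Data.List.Membership.Propositional.Properties
  using (∈-∃++; ∈-++⁻; ∈-++⁺ˡ; ∈-++⁺ʳ; ∈-map∘filter⁻; ∈-filter⁺; ∈-filter⁻; ∈-allFin;
         ∈-cartesianProductWith⁺)
open import Data.List.Relation.Binary.Subset.Propositional using (_⊆_)
open import Data.List.Relation.Binary.Disjoint.Propositional using (Disjoint)
open import Data.List.Relation.Unary.Any as Any using (Any; here; there; toSum; fromSum)
open import Data.List.Relation.Unary.All as All using (All)
open import Data.List.Relation.Unary.AllPairs as AllPairs using (AllPairs; []; _∷_)
import Data.List.Relation.Unary.AllPairs.Properties as AllPairs
open import Data.List.Relation.Unary.Unique.Propositional using (Unique)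
import Data.List.Relation.Unary.Unique.Propositional.Properties as Unique
open import Data.Product using (∃; _×_; _,_; proj₁; proj₂)
open import Data.Sum as Sum using (_⊎_; inj₁; inj₂)
open import Data.Empty using (⊥-elim)
open import Relation.Nullary using (¬_; Dec; yes; no)
open import Relation.Nullary.Decidable using (_×-dec_; _⊎-dec_; ¬?)
open import Relation.Unary using (Pred) renaming (Decidable to Decidable₁)
open import Relation.Binary using (Rel; Decidable; _⇒_)
open import Relation.Binary.Construct.Union using (_∪_) renaming (decidable to ∪-dec)
open import Relation.Binary.PropositionalEquality

open import Defs

module _ {A : Set} where

  count : {P : Pred A 0ℓ} → Decidable₁ P → List A → ℕ
  count P? xs = length (filter P? xs)

  count-cong : ∀ {P Q : Pred A 0ℓ} (P? : Decidable₁ P) (Q? : Decidable₁ Q) →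
               (∀ x → P x → Q x) → (∀ x → Q x → P x) → ∀ xs → count P? xs ≡ count Q? xs
  count-cong P? Q? P⇒Q Q⇒P xs = cong length (filter-≐ P? Q? ((λ {x} → P⇒Q x) , (λ {x} → Q⇒P x)) xs)

  count-⊎ : ∀ {P Q : Pred A 0ℓ} (P? : Decidable₁ P) (Q? : Decidable₁ Q) →
            (∀ x → P x → ¬ Q x) → ∀ xs →
            count (λ x → P? x ⊎-dec Q? x) xs ≡ count P? xs + count Q? xs
  count-⊎ P? Q? disjoint [] = refl
  count-⊎ P? Q? disjoint (x ∷ xs) with P? x | Q? x
  ... | yes p | yes q = ⊥-elim (disjoint x p q)
  ... | yes _ | no _  = cong suc (count-⊎ P? Q? disjoint xs)
  ... | no _  | yes _ = trans (cong suc (count-⊎ P? Q? disjoint xs)) (sym (ℕ.+-suc _ _))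
  ... | no _  | no _  = count-⊎ P? Q? disjoint xs

  Unique-⊆⇒length-≤ : ∀ {xs ys : List A} → Unique xs → xs ⊆ ys → length xs ℕ.≤ length ys
  Unique-⊆⇒length-≤ {[]}     _            _     = z≤n
  Unique-⊆⇒length-≤ {x ∷ xs} {ys} (x∉xs ∷ uxs) xs⊆ys with ∈-∃++ (xs⊆ys (here refl))
  ... | us , vs , refl = begin
    suc (length xs)             ≤⟨ s≤s (Unique-⊆⇒length-≤ uxs xs⊆us++vs) ⟩
    suc (length (us ++ vs))     ≡⟨ cong suc (length-++ us) ⟩
    suc (length us + length vs) ≡⟨ ℕ.+-suc (length us) (length vs) ⟨
    length us + suc (length vs) ≡⟨ length-++ us ⟨
    length (us ++ x ∷ vs)       ∎
    where
    open ℕ.≤-Reasoning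
    xs⊆us++vs : xs ⊆ us ++ vs
    xs⊆us++vs y∈xs with ∈-++⁻ us (xs⊆ys (there y∈xs))
    ... | inj₁ y∈us         = ∈-++⁺ˡ y∈us
    ... | inj₂ (here refl)  = ⊥-elim (All.lookup x∉xs y∈xs refl)
    ... | inj₂ (there y∈vs) = ∈-++⁺ʳ us y∈vs

  count-≤-injective : ∀ {P Q : Pred A 0ℓ} (P? : Decidable₁ P) (Q? : Decidable₁ Q) {xs} →
                      Unique xs → (∀ x → x ∈ xs) → (f : A → A) → (∀ {x y} → f x ≡ f y → x ≡ y) →
                      (∀ {x} → P x → Q (f x)) → count P? xs ℕ.≤ count Q? xs
  count-≤-injective P? Q? {xs} unique complete f f-inj P⇒Qf =
    subst (ℕ._≤ count Q? xs) (length-map f (filter P? xs))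
      (Unique-⊆⇒length-≤ (Unique.map⁺ f-inj (Unique.filter⁺ P? unique)) image⊆)
    where
    image⊆ : map f (filter P? xs) ⊆ filter Q? xs
    image⊆ y∈ with ∈-map∘filter⁻ f P? {xs = xs} y∈
    ... | x , _ , refl , px = ∈-filter⁺ Q? (complete (f x)) (P⇒Qf px)

  count-≡-inverse : ∀ {P Q : Pred A 0ℓ} (P? : Decidable₁ P) (Q? : Decidable₁ Q) {xs} →
                    Unique xs → (∀ x → x ∈ xs) → (f g : A → A) →
                    (∀ x → g (f x) ≡ x) → (∀ x → f (g x) ≡ x) →
                    (∀ {x} → P x → Q (f x)) → (∀ {x} → Q x → P (g x)) → count P? xs ≡ count Q? xs
  count-≡-inverse P? Q? unique complete f g gf fg P⇒Qf Q⇒Pg = ℕ.≤-antisym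
    (count-≤-injective P? Q? unique complete f (injective f g gf) P⇒Qf)
    (count-≤-injective Q? P? unique complete g (injective g f fg) Q⇒Pg)
    where
    injective : ∀ (h k : A → A) → (∀ x → k (h x) ≡ x) → ∀ {x y} → h x ≡ h y → x ≡ y
    injective h k kh {x} {y} hx≡hy = trans (sym (kh x)) (trans (cong k hx≡hy) (kh y))

Unique⇒AllPairs : ∀ {A : Set} {R : Rel A 0ℓ} {xs} → Unique xs →
                  (∀ {x y} → x ∈ xs → y ∈ xs → x ≢ y → R x y) → AllPairs R xs
Unique⇒AllPairs []                 _ = []
Unique⇒AllPairs (x∉xs ∷ unique) R≢ =
  All.tabulate (λ y∈ → R≢ (here refl) (there y∈) (All.lookup x∉xs y∈))
  ∷ Unique⇒AllPairs unique (λ x∈ y∈ → R≢ (there x∈) (there y∈))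

concatMap-map≡cartesianProductWith : ∀ {A B C : Set} (f : A → B → C) xs ys →
  concatMap (λ x → map (f x) ys) xs ≡ cartesianProductWith f xs ys
concatMap-map≡cartesianProductWith f []       ys = refl
concatMap-map≡cartesianProductWith f (x ∷ xs) ys =
  cong (map (f x) ys ++_) (concatMap-map≡cartesianProductWith f xs ys)

module _ (m : ℕ) where

  allVecs-suc : ∀ k → allVecs m (suc k) ≡ cartesianProductWith _∷_ (allFin m) (allVecs m k)
  allVecs-suc k = concatMap-map≡cartesianProductWith _∷_ (allFin m) (allVecs m k)

  ∈-allVecs : ∀ {k} (v : Vec (Fin m) k) → v ∈ allVecs m k
  ∈-allVecs []               = here refl
  ∈-allVecs {suc k} (x ∷ v) = subst (x ∷ v ∈_) (sym (allVecs-suc k))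
    (∈-cartesianProductWith⁺ _∷_ (∈-allFin x) (∈-allVecs v))

  allVecs-unique : ∀ k → Unique (allVecs m k)
  allVecs-unique zero    = All.[] ∷ []
  allVecs-unique (suc k) = subst Unique (sym (allVecs-suc k))
    (Unique.cartesianProductWith⁺ _∷_ ∷-injective (Unique.allFin⁺ m) (allVecs-unique k))

injective⇒surjective : ∀ {n} (f : Fin n → Fin n) → (∀ i j → f i ≡ f j → i ≡ j) →
                       ∀ x → ∃ λ i → f i ≡ x
injective⇒surjective {suc m} f f-inj x with any? (λ i → f i ≟ x)
... | yes hit = hit
... | no miss = ⊥-elim (collision (pigeonhole (ℕ.n<1+n m) (λ i → punchOut (x≢f i))))
  where
  x≢f : ∀ i → x ≢ f i
  x≢f i x≡fi = miss (i , sym x≡fi)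
  collision : ¬ ∃ λ i → ∃ λ j → i < j × punchOut (x≢f i) ≡ punchOut (x≢f j)
  collision (i , j , i<j , eq) = <⇒≢ i<j (f-inj i j (punchOut-injective (x≢f i) (x≢f j) eq))

∃-least : ∀ {m} {P : Pred (Fin m) 0ℓ} → Decidable₁ P → ∃ P → ∃ λ i → P i × (∀ {j} → P j → i ≤ j)
∃-least {suc m} P? (i , pi) with P? zero
... | yes p0 = zero , p0 , λ _ → z≤n
... | no ¬p0 with i
...   | zero   = ⊥-elim (¬p0 pi)
...   | suc i′ with ∃-least (P? ∘ suc) (i′ , pi)
...     | k , pk , least = suc k , pk , λ { {zero} p0 → ⊥-elim (¬p0 p0) ; {suc j} pj → s≤s (least pj) }

module _ {A : Set} where

  record Twins (R : Rel A 0ℓ) (L : List A) : Set where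
    field
      same-pred : ∀ {z t t′} → t ∈ L → t′ ∈ L → R z t → R z t′
      same-succ : ∀ {z t t′} → t ∈ L → t′ ∈ L → R t z → R t′ z
      unrelated : ∀ {t t′} → t ∈ L → t′ ∈ L → ¬ R t t′

  open Twins

  Twins-⊆ : ∀ {R L L′} → L′ ⊆ L → Twins R L → Twins R L′
  Twins-⊆ L′⊆L tw = record
    { same-pred = λ t∈ t′∈ → same-pred tw (L′⊆L t∈) (L′⊆L t′∈)
    ; same-succ = λ t∈ t′∈ → same-succ tw (L′⊆L t∈) (L′⊆L t′∈)
    ; unrelated = λ t∈ t′∈ → unrelated tw (L′⊆L t∈) (L′⊆L t′∈)
    }

  Twins-∪ : ∀ {R S L} → Twins R L → Twins S L → Twins (R ∪ S) L
  Twins-∪ twR twS = record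
    { same-pred = λ t∈ t′∈ → Sum.map (same-pred twR t∈ t′∈) (same-pred twS t∈ t′∈)
    ; same-succ = λ t∈ t′∈ → Sum.map (same-succ twR t∈ t′∈) (same-succ twS t∈ t′∈)
    ; unrelated = λ t∈ t′∈ → Sum.[ unrelated twR t∈ t′∈ , unrelated twS t∈ t′∈ ]
    }

  Twins-Disjoint : ∀ {R L L′} → (∀ {x y} → R x y → x ∈ L′ × y ∈ L′) → Disjoint L L′ → Twins R L
  Twins-Disjoint R⊆L′² disjoint = record
    { same-pred = λ t∈ _ r → ⊥-elim (disjoint (t∈ , proj₂ (R⊆L′² r)))
    ; same-succ = λ t∈ _ r → ⊥-elim (disjoint (t∈ , proj₁ (R⊆L′² r)))
    ; unrelated = λ t∈ _ r → disjoint (t∈ , proj₁ (R⊆L′² r))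
    }

  Twins-invariant : ∀ {R L} → Twins R L → (σ : A → A) → (∀ x → σ x ≡ x ⊎ x ∈ L × σ x ∈ L) →
                    ∀ {x y} → R x y → R (σ x) (σ y)
  Twins-invariant {R} tw σ within {x} {y} r with within x | within y
  ... | inj₁ σx≡x          | inj₁ σy≡y          = subst₂ R (sym σx≡x) (sym σy≡y) r
  ... | inj₁ σx≡x          | inj₂ (y∈ , σy∈)    = subst (λ a → R a (σ y)) (sym σx≡x) (same-pred tw y∈ σy∈ r)
  ... | inj₂ (x∈ , σx∈)    | inj₁ σy≡y          = subst (R (σ x)) (sym σy≡y) (same-succ tw x∈ σx∈ r)
  ... | inj₂ (x∈ , _)      | inj₂ (y∈ , _)      = ⊥-elim (unrelated tw x∈ y∈ r)



module _ {n : ℕ} where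

  transpose-matchˡ : (i j : Fin n) → transpose i j i ≡ j
  transpose-matchˡ i j with i ≟ i
  ... | yes _   = refl
  ... | no i≢i = ⊥-elim (i≢i refl)

  transpose-matchʳ : (i j : Fin n) → transpose i j j ≡ i
  transpose-matchʳ i j with j ≟ i
  ... | yes j≡i = j≡i
  ... | no _ with j ≟ j
  ...   | yes _   = refl
  ...   | no j≢j = ⊥-elim (j≢j refl)

  transpose-mismatch : ∀ {i j k : Fin n} → k ≢ i → k ≢ j → transpose i j k ≡ k
  transpose-mismatch {i} {j} {k} k≢i k≢j with k ≟ i
  ... | yes k≡i = ⊥-elim (k≢i k≡i)
  ... | no _ with k ≟ j
  ...   | yes k≡j = ⊥-elim (k≢j k≡j)
  ...   | no _    = refl

  transpose-within : ∀ {i j : Fin n} {L} → i ∈ L → j ∈ L →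
                     ∀ k → transpose i j k ≡ k ⊎ k ∈ L × transpose i j k ∈ L
  transpose-within {i} {j} {L} i∈ j∈ k = cases (k ≟ i) (k ≟ j)
    where
    cases : Dec (k ≡ i) → Dec (k ≡ j) → transpose i j k ≡ k ⊎ k ∈ L × transpose i j k ∈ L
    cases (yes refl) _          = inj₂ (i∈ , subst (_∈ L) (sym (transpose-matchˡ i j)) j∈)
    cases (no _)     (yes refl) = inj₂ (j∈ , subst (_∈ L) (sym (transpose-matchʳ i j)) i∈)
    cases (no k≢i)   (no k≢j)   = inj₁ (transpose-mismatch k≢i k≢j)

  IsLinExt-antitone : ∀ {R R′ : Rel (Fin n) 0ℓ} → R ⇒ R′ → ∀ {v} → IsLinExt R′ v → IsLinExt R v
  IsLinExt-antitone R⇒R′ (inj , ord) = inj , λ i j r → ord i j (R⇒R′ r)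

  LE-cong : ∀ {R R′ : Rel (Fin n) 0ℓ} (R? : Decidable R) (R′? : Decidable R′) →
            R ⇒ R′ → R′ ⇒ R → LE-rel R R? ≡ LE-rel R′ R′?
  LE-cong {R} {R′} R? R′? R⇒R′ R′⇒R = count-cong (isLinExt? _ R?) (isLinExt? _ R′?)
    (λ v → IsLinExt-antitone {R′} {R} R′⇒R {v}) (λ v → IsLinExt-antitone {R} {R′} R⇒R′ {v}) (allVecs n n)

  IsLinExt-map : ∀ {R R′ : Rel (Fin n) 0ℓ} (φ ψ : Fin n → Fin n) → (∀ x → ψ (φ x) ≡ x) →
                 (∀ {x y} → R′ x y → R (ψ x) (ψ y)) → ∀ {v} → IsLinExt R v → IsLinExt R′ (Vec.map φ v)
  IsLinExt-map {R} {R′} φ ψ ψφ R′⇒Rψ {v} (inj , ord) = inj′ , ord′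
    where
    ψ∘lookup : ∀ k → ψ (lookup (Vec.map φ v) k) ≡ lookup v k
    ψ∘lookup k = trans (cong ψ (lookup-map k φ v)) (ψφ (lookup v k))
    inj′ : ∀ i j → lookup (Vec.map φ v) i ≡ lookup (Vec.map φ v) j → i ≡ j
    inj′ i j eq = inj i j (trans (sym (ψ∘lookup i)) (trans (cong ψ eq) (ψ∘lookup j)))
    ord′ : ∀ i j → R′ (lookup (Vec.map φ v) i) (lookup (Vec.map φ v) j) → i < j
    ord′ i j r = ord i j (subst₂ R (ψ∘lookup i) (ψ∘lookup j) (R′⇒Rψ r))

  LE-transport : ∀ {R R′ : Rel (Fin n) 0ℓ} (R? : Decidable R) (R′? : Decidable R′) (φ ψ : Fin n → Fin n) →
                 (∀ x → ψ (φ x) ≡ x) → (∀ x → φ (ψ x) ≡ x) →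
                 (∀ {x y} → R x y → R′ (φ x) (φ y)) → (∀ {x y} → R′ x y → R (ψ x) (ψ y)) →
                 LE-rel R R? ≡ LE-rel R′ R′?
  LE-transport {R} {R′} R? R′? φ ψ ψφ φψ R⇒R′φ R′⇒Rψ =
    count-≡-inverse (isLinExt? _ R?) (isLinExt? _ R′?) (allVecs-unique n n) (∈-allVecs n)
      (Vec.map φ) (Vec.map ψ) (map-inverse ψφ) (map-inverse φψ)
      (λ {v} → IsLinExt-map {R} {R′} φ ψ ψφ R′⇒Rψ {v})
      (λ {v} → IsLinExt-map {R′} {R} ψ φ φψ R⇒R′φ {v})
    where
    map-inverse : ∀ {f g : Fin n → Fin n} → (∀ x → g (f x) ≡ x) → ∀ {k} (v : Vec (Fin n) k) →
                  Vec.map g (Vec.map f v) ≡ v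
    map-inverse gf []      = refl
    map-inverse gf (x ∷ v) = cong₂ _∷_ (gf x) (map-inverse gf v)

  FirstOf : List (Fin n) → Fin n → Rel (Fin n) 0ℓ
  FirstOf L t x y = x ≡ t × y ∈ L × y ≢ t

  open import Data.List.Membership.DecPropositional (_≟_ {n = n}) using (_∈?_)

  firstOf? : ∀ L t → Decidable (FirstOf L t)
  firstOf? L t x y = (x ≟ t) ×-dec ((y ∈? L) ×-dec ¬? (y ≟ t))

  firstOf-exists : ∀ {R L s} → s ∈ L → ∀ {v} → IsLinExt R v →
                   ∃ λ t → t ∈ L × IsLinExt (R ∪ FirstOf L t) v
  firstOf-exists {R} {L} s∈ {v} (inj , ord)
    with is , vis≡s ← injective⇒surjective (lookup v) inj _
    with i₀ , vi₀∈ , least ← ∃-least (λ i → lookup v i ∈? L) (is , subst (_∈ L) (sym vis≡s) s∈)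
    = lookup v i₀ , vi₀∈ , inj , ord′
    where
    ord′ : ∀ i j → (R ∪ FirstOf L (lookup v i₀)) (lookup v i) (lookup v j) → i < j
    ord′ i j (inj₁ r) = ord i j r
    ord′ i j (inj₂ (vi≡vi₀ , vj∈ , vj≢vi₀)) with inj i i₀ vi≡vi₀
    ... | refl = ≤∧≢⇒< (least vj∈) (λ i≡j → vj≢vi₀ (cong (lookup v) (sym i≡j)))

  firstOf-unique : ∀ {L t t′ v} → t ∈ L → t′ ∈ L →
                   IsLinExt (FirstOf L t) v → IsLinExt (FirstOf L t′) v → t ≡ t′
  firstOf-unique {L} {t} {t′} {v} t∈ t′∈ (inj , ord) (_ , ord′) with t ≟ t′
  ... | yes t≡t′ = t≡t′
  ... | no t≢t′
    with i , vi≡t ← injective⇒surjective (lookup v) inj t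
    with j , vj≡t′ ← injective⇒surjective (lookup v) inj t′
    = ⊥-elim (<-asym (ord i j (vi≡t , vj∈ , vj≢t)) (ord′ j i (vj≡t′ , vi∈ , vi≢t′)))
    where
    vj∈ : lookup v j ∈ L
    vj∈ = subst (_∈ L) (sym vj≡t′) t′∈
    vi∈ : lookup v i ∈ L
    vi∈ = subst (_∈ L) (sym vi≡t) t∈
    vj≢t : lookup v j ≢ t
    vj≢t vj≡t = t≢t′ (trans (sym vj≡t) vj≡t′)
    vi≢t′ : lookup v i ≢ t′
    vi≢t′ vi≡t′ = t≢t′ (trans (sym vi≡t) vi≡t′)

  ∪FirstOf-transpose : ∀ {R L t t′} → Twins R L → t ∈ L → t′ ∈ L → ∀ {x y} →
                       (R ∪ FirstOf L t) x y → (R ∪ FirstOf L t′) (transpose t t′ x) (transpose t t′ y)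
  ∪FirstOf-transpose tw t∈ t′∈ (inj₁ r) = inj₁ (Twins-invariant tw _ (transpose-within t∈ t′∈) r)
  ∪FirstOf-transpose {L = L} {t} {t′} tw t∈ t′∈ {y = y} (inj₂ (refl , y∈ , y≢t)) =
    inj₂ (transpose-matchˡ t t′ , σy∈ (transpose-within t∈ t′∈ y) , σy≢t′)
    where
    σy∈ : transpose t t′ y ≡ y ⊎ y ∈ L × transpose t t′ y ∈ L → transpose t t′ y ∈ L
    σy∈ (inj₁ σy≡y)    = subst (_∈ L) (sym σy≡y) y∈
    σy∈ (inj₂ (_ , p)) = p
    σy≢t′ : transpose t t′ y ≢ t′
    σy≢t′ σy≡t′ = y≢t (begin
      y                                 ≡⟨ transpose-inverse t′ t ⟨
      transpose t′ t (transpose t t′ y) ≡⟨ cong (transpose t′ t) σy≡σt ⟩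
      transpose t′ t (transpose t t′ t) ≡⟨ transpose-inverse t′ t ⟩
      t                                 ∎)
      where
      open ≡-Reasoning
      σy≡σt : transpose t t′ y ≡ transpose t t′ t
      σy≡σt = trans σy≡t′ (sym (transpose-matchˡ t t′))

  module _ {R : Rel (Fin n) 0ℓ} (R? : Decidable R) where

    LE-first : List (Fin n) → Fin n → ℕ
    LE-first L t = LE-rel (R ∪ FirstOf L t) (∪-dec R? (firstOf? L t))

    LE-first-swap : ∀ {L t t′} → Twins R L → t ∈ L → t′ ∈ L → LE-first L t ≡ LE-first L t′
    LE-first-swap {L} {t} {t′} tw t∈ t′∈ =
      LE-transport (∪-dec R? (firstOf? L t)) (∪-dec R? (firstOf? L t′)) (transpose t t′) (transpose t′ t)
        (λ _ → transpose-inverse t′ t) (λ _ → transpose-inverse t t′)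
        (∪FirstOf-transpose tw t∈ t′∈) (∪FirstOf-transpose tw t′∈ t∈)

    -- Linear extensions of R are partitioned by which element of L they list first.
    LE-via-first : ∀ {L s} → Unique L → Twins R L → s ∈ L → LE-rel R R? ≡ length L * LE-first L s
    LE-via-first {L} {s} uniqueL tw s∈ = begin
      LE-rel R R?                      ≡⟨ count-cong _ (leadsIn? L) some-leader leader⇒LinExt (allVecs n n) ⟩
      count (leadsIn? L) (allVecs n n) ≡⟨ count-leaders L uniqueL (λ t∈ → t∈) ⟩
      length L * LE-first L s          ∎
      where
      open ≡-Reasoning
      Leads : Fin n → Pred (Vec (Fin n) n) 0ℓ
      Leads t = IsLinExt (R ∪ FirstOf L t)
      leadsIn? : ∀ T → Decidable₁ (λ v → Any (λ t → Leads t v) T)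
      leadsIn? T v = Any.any? (λ t → isLinExt? _ (∪-dec R? (firstOf? L t)) v) T
      some-leader : ∀ v → IsLinExt R v → Any (λ t → Leads t v) L
      some-leader v le with _ , t∈ , lead ← firstOf-exists {R} s∈ {v} le = lose t∈ lead
      leader⇒LinExt : ∀ v → Any (λ t → Leads t v) L → IsLinExt R v
      leader⇒LinExt v lead = IsLinExt-antitone {R} {R ∪ FirstOf L _} inj₁ {v} (proj₂ (Any.satisfied lead))
      count-leaders : ∀ T → Unique T → T ⊆ L → count (leadsIn? T) (allVecs n n) ≡ length T * LE-first L s
      count-leaders []      _              _    =
        cong length (filter-none (leadsIn? []) (All.universal (λ _ ()) (allVecs n n)))
      count-leaders (t ∷ T) (t∉T ∷ uniqueT) T⊆L = begin
        count (leadsIn? (t ∷ T)) (allVecs n n)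
          ≡⟨ count-cong _ _ (λ _ → toSum) (λ _ → fromSum) (allVecs n n) ⟩
        count (λ v → isLinExt? _ (∪-dec R? (firstOf? L t)) v ⊎-dec leadsIn? T v) (allVecs n n)
          ≡⟨ count-⊎ (isLinExt? _ (∪-dec R? (firstOf? L t))) (leadsIn? T) distinct-leaders (allVecs n n) ⟩
        LE-first L t + count (leadsIn? T) (allVecs n n)
          ≡⟨ cong₂ _+_ (LE-first-swap tw (T⊆L (here refl)) s∈) (count-leaders T uniqueT (T⊆L ∘ there)) ⟩
        LE-first L s + length T * LE-first L s
          ∎
        where
        distinct-leaders : ∀ v → Leads t v → ¬ Any (λ t′ → Leads t′ v) T
        distinct-leaders v lead leadT with t′ , t′∈T , lead′ ← find leadT =
          All.lookup t∉T t′∈T (firstOf-unique {v = v} (T⊆L (here refl)) (T⊆L (there t′∈T))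
                                (IsLinExt-antitone {FirstOf L t} {R ∪ FirstOf L t} inj₂ {v} lead)
                                (IsLinExt-antitone {FirstOf L t′} {R ∪ FirstOf L t′} inj₂ {v} lead′))

  Chain : List (Fin n) → Rel (Fin n) 0ℓ
  Chain L x y = x ∈ L × y ∈ L × x < y

  chain? : ∀ L → Decidable (Chain L)
  chain? L x y = (x ∈? L) ×-dec ((y ∈? L) ×-dec (x Fin.<? y))

  FirstOf-Twins : ∀ {t L} → t ∉ L → Twins (FirstOf (t ∷ L) t) L
  FirstOf-Twins t∉L = record
    { same-pred = λ _ t′∈ (z≡t , _ , _) → z≡t , there t′∈ , λ { refl → t∉L t′∈ }
    ; same-succ = λ { t∈ _ (refl , _) → ⊥-elim (t∉L t∈) }
    ; unrelated = λ { t∈ _ (refl , _) → t∉L t∈ }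
    }

  LE-chain : ∀ {R : Rel (Fin n) 0ℓ} (R? : Decidable R) L → AllPairs _<_ L → Twins R L →
             LE-rel R R? ≡ length L ! * LE-rel (R ∪ Chain L) (∪-dec R? (chain? L))
  LE-chain {R} R? [] _ _ =
    trans (LE-cong R? (∪-dec R? (chain? [])) inj₁ λ { (inj₁ r) → r ; (inj₂ (() , _)) })
          (sym (ℕ.+-identityʳ _))
  LE-chain {R} R? (s ∷ L) (s<L ∷ sorted) tw = begin
    LE-rel R R?
      ≡⟨ LE-via-first R? (AllPairs.map <⇒≢ (s<L ∷ sorted)) tw (here refl) ⟩
    suc k * LE-rel R₁ R₁?
      ≡⟨ cong (suc k *_) (LE-chain R₁? L sorted tw₁) ⟩
    suc k * (k ! * LE-rel (R₁ ∪ Chain L) R₁∪L?)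
      ≡⟨ cong (λ c → suc k * (k ! * c)) (LE-cong R₁∪L? R∪sL? merge split) ⟩
    suc k * (k ! * LE-rel R∪sL R∪sL?)
      ≡⟨ ℕ.*-assoc (suc k) (k !) _ ⟨
    suc k ! * LE-rel R∪sL R∪sL?
      ∎
    where
    open ≡-Reasoning
    k : ℕ
    k = length L
    R₁ : Rel (Fin n) 0ℓ
    R₁ = R ∪ FirstOf (s ∷ L) s
    R₁? : Decidable R₁
    R₁? = ∪-dec R? (firstOf? (s ∷ L) s)
    R₁∪L? : Decidable (R₁ ∪ Chain L)
    R₁∪L? = ∪-dec R₁? (chain? L)
    R∪sL : Rel (Fin n) 0ℓ
    R∪sL = R ∪ Chain (s ∷ L)
    R∪sL? : Decidable R∪sL
    R∪sL? = ∪-dec R? (chain? (s ∷ L))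
    s∉L : s ∉ L
    s∉L s∈L = <-irrefl refl (All.lookup s<L s∈L)
    tw₁ : Twins R₁ L
    tw₁ = Twins-∪ (Twins-⊆ there tw) (FirstOf-Twins s∉L)
    merge : R₁ ∪ Chain L ⇒ R∪sL
    merge (inj₁ (inj₁ r))                         = inj₁ r
    merge (inj₁ (inj₂ (refl , here refl , y≢s)))  = ⊥-elim (y≢s refl)
    merge (inj₁ (inj₂ (refl , there y∈ , _)))     = inj₂ (here refl , there y∈ , All.lookup s<L y∈)
    merge (inj₂ (x∈ , y∈ , x<y))                  = inj₂ (there x∈ , there y∈ , x<y)
    split : R∪sL ⇒ R₁ ∪ Chain L
    split (inj₁ r)                               = inj₁ (inj₁ r)
    split (inj₂ (here refl , here refl , s<s))   = ⊥-elim (<-irrefl refl s<s)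
    split (inj₂ (here refl , there y∈ , _))      = inj₁ (inj₂ (refl , there y∈ , λ { refl → s∉L y∈ }))
    split (inj₂ (there x∈ , here refl , x<s))    = ⊥-elim (<-asym x<s (All.lookup s<L x∈))
    split (inj₂ (there x∈ , there y∈ , x<y))     = inj₂ (x∈ , y∈ , x<y)

  Chains : {I : Set} → (I → List (Fin n)) → List I → Rel (Fin n) 0ℓ
  Chains cls rs x y = Any (λ r → Chain (cls r) x y) rs

  chains? : {I : Set} (cls : I → List (Fin n)) (rs : List I) → Decidable (Chains cls rs)
  chains? cls rs x y = Any.any? (λ r → chain? (cls r) x y) rs

  LE-chains : ∀ {I : Set} {R : Rel (Fin n) 0ℓ} (R? : Decidable R) (cls : I → List (Fin n)) rs →
              AllPairs (λ r r′ → Disjoint (cls r) (cls r′)) rs →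
              (∀ {r} → r ∈ rs → AllPairs _<_ (cls r)) → (∀ {r} → r ∈ rs → Twins R (cls r)) →
              LE-rel R R? ≡ LE-rel (R ∪ Chains cls rs) (∪-dec R? (chains? cls rs))
                            * foldr (λ r p → length (cls r) ! * p) 1 rs
  LE-chains R? cls [] _ _ _ =
    trans (LE-cong R? (∪-dec R? (chains? cls [])) inj₁ λ { (inj₁ r) → r ; (inj₂ ()) })
          (sym (ℕ.*-identityʳ _))
  LE-chains {R = R} R? cls (r ∷ rs) (r#rs ∷ disjoint) sorted twins = begin
    LE-rel R R?
      ≡⟨ LE-chain R? (cls r) (sorted (here refl)) (twins (here refl)) ⟩
    c * LE-rel R₁ R₁?
      ≡⟨ cong (c *_) (LE-chains R₁? cls rs disjoint (sorted ∘ there) twins₁) ⟩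
    c * (LE-rel (R₁ ∪ Chains cls rs) R₁∪rs? * π)
      ≡⟨ cong (λ e → c * (e * π)) (LE-cong R₁∪rs? R∪rs? merge split) ⟩
    c * (LE-rel R∪rs R∪rs? * π)
      ≡⟨ x∙yz≈y∙xz c (LE-rel R∪rs R∪rs?) π ⟩
    LE-rel R∪rs R∪rs? * (c * π)
      ∎
    where
    open ≡-Reasoning
    open import Algebra.Properties.CommutativeSemigroup ℕ.*-commutativeSemigroup using (x∙yz≈y∙xz)
    c π : ℕ
    c = length (cls r) !
    π = foldr (λ r p → length (cls r) ! * p) 1 rs
    R₁ : Rel (Fin n) 0ℓ
    R₁ = R ∪ Chain (cls r)
    R₁? : Decidable R₁
    R₁? = ∪-dec R? (chain? (cls r))
    R₁∪rs? : Decidable (R₁ ∪ Chains cls rs)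
    R₁∪rs? = ∪-dec R₁? (chains? cls rs)
    R∪rs : Rel (Fin n) 0ℓ
    R∪rs = R ∪ Chains cls (r ∷ rs)
    R∪rs? : Decidable R∪rs
    R∪rs? = ∪-dec R? (chains? cls (r ∷ rs))
    twins₁ : ∀ {r′} → r′ ∈ rs → Twins R₁ (cls r′)
    twins₁ r′∈ = Twins-∪ (twins (there r′∈))
      (Twins-Disjoint (λ (x∈ , y∈ , _) → x∈ , y∈)
                      (λ (x∈′ , x∈) → All.lookup r#rs r′∈ (x∈ , x∈′)))
    merge : R₁ ∪ Chains cls rs ⇒ R∪rs
    merge (inj₁ (inj₁ x≺y))   = inj₁ x≺y
    merge (inj₁ (inj₂ chain)) = inj₂ (here chain)
    merge (inj₂ chains)       = inj₂ (there chains)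
    split : R∪rs ⇒ R₁ ∪ Chains cls rs
    split (inj₁ x≺y)           = inj₁ (inj₁ x≺y)
    split (inj₂ (here chain))  = inj₁ (inj₂ chain)
    split (inj₂ (there chains)) = inj₂ chains

module Classes {n : ℕ} (P : Poset n) (M : List (Fin n × Fin n)) where
  open Poset P renaming (trans to ≺-trans)
  open Construction P M

  SameN-refl : ∀ x → SameN P x x
  SameN-refl x z = (λ c → c) , (λ c → c)

  SameN-sym : ∀ {x y} → SameN P x y → SameN P y x
  SameN-sym same z = proj₂ (same z) , proj₁ (same z)

  SameN-trans : ∀ {x y w} → SameN P x y → SameN P y w → SameN P x w
  SameN-trans xy yw z = proj₁ (yw z) ∘ proj₁ (xy z) , proj₂ (xy z) ∘ proj₂ (yw z)

  SameN⇒¬≺ : ∀ {x y} → SameN P x y → ¬ x ≺ y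
  SameN⇒¬≺ {x} {y} same x≺y with proj₁ (same y) (inj₁ x≺y)
  ... | inj₁ y≺y = irrefl y y≺y
  ... | inj₂ y≺y = irrefl y y≺y

  ≺-respʳ-SameN : ∀ {z t t′} → SameN P t t′ → z ≺ t → z ≺ t′
  ≺-respʳ-SameN {z} same z≺t with proj₁ (same z) (inj₂ z≺t)
  ... | inj₁ t′≺z = ⊥-elim (SameN⇒¬≺ (SameN-sym same) (≺-trans t′≺z z≺t))
  ... | inj₂ z≺t′ = z≺t′

  ≺-respˡ-SameN : ∀ {z t t′} → SameN P t t′ → t ≺ z → t′ ≺ z
  ≺-respˡ-SameN {z} same t≺z with proj₁ (same z) (inj₁ t≺z)
  ... | inj₁ t′≺z = t′≺z
  ... | inj₂ z≺t′ = ⊥-elim (SameN⇒¬≺ same (≺-trans t≺z z≺t′))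

  SameN-Twins : ∀ {L} → (∀ {t t′} → t ∈ L → t′ ∈ L → SameN P t t′) → Twins _≺_ L
  SameN-Twins same = record
    { same-pred = λ t∈ t′∈ → ≺-respʳ-SameN (same t∈ t′∈)
    ; same-succ = λ t∈ t′∈ → ≺-respˡ-SameN (same t∈ t′∈)
    ; unrelated = λ t∈ t′∈ → SameN⇒¬≺ (same t∈ t′∈)
    }

  class : Fin n → List (Fin n)
  class r = filter (λ y → inA? y ×-dec sameN? P y r) (allFin n)

  ∈-class⁻ : ∀ {r y} → y ∈ class r → InA y × SameN P y r
  ∈-class⁻ {r} y∈ = proj₂ (∈-filter⁻ (λ y → inA? y ×-dec sameN? P y r) {xs = allFin n} y∈)

  ∈-class⁺ : ∀ {r y} → InA y → SameN P y r → y ∈ class r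
  ∈-class⁺ {r} {y} ay same = ∈-filter⁺ (λ y → inA? y ×-dec sameN? P y r) (∈-allFin y) (ay , same)

  class-sorted : ∀ r → AllPairs _<_ (class r)
  class-sorted r = AllPairs.filter⁺ _ (AllPairs.tabulate⁺-< (λ i<j → i<j))

  class-Twins : ∀ r → Twins _≺_ (class r)
  class-Twins r = SameN-Twins λ t∈ t′∈ →
    SameN-trans (proj₂ (∈-class⁻ t∈)) (SameN-sym (proj₂ (∈-class⁻ t′∈)))

  reps : List (Fin n)
  reps = filter isRep? (allFin n)

  ∈-reps⁻ : ∀ {r} → r ∈ reps → IsRep r
  ∈-reps⁻ r∈ = proj₂ (∈-filter⁻ isRep? {xs = allFin n} r∈)

  IsRep-unique : ∀ {r r′ x} → IsRep r → IsRep r′ → x ∈ class r → x ∈ class r′ → r ≡ r′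
  IsRep-unique (ar , r≤) (ar′ , r′≤) x∈ x∈′ = ≤-antisym
    (r≤ _ ar′ (SameN-trans (SameN-sym (proj₂ (∈-class⁻ x∈′))) (proj₂ (∈-class⁻ x∈))))
    (r′≤ _ ar (SameN-trans (SameN-sym (proj₂ (∈-class⁻ x∈))) (proj₂ (∈-class⁻ x∈′))))

  classes-disjoint : AllPairs (λ r r′ → Disjoint (class r) (class r′)) reps
  classes-disjoint = Unique⇒AllPairs (Unique.filter⁺ isRep? (Unique.allFin⁺ n))
    λ r∈ r′∈ r≢r′ (x∈ , x∈′) → r≢r′ (IsRep-unique (∈-reps⁻ r∈) (∈-reps⁻ r′∈) x∈ x∈′)

  class-of : ∀ {x} → InA x → Any (λ r → x ∈ class r) reps
  class-of {x} ax with r , (ar , r~x) , least ← ∃-least (λ z → inA? z ×-dec sameN? P z x) (x , ax , SameN-refl x)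
    = lose (∈-filter⁺ isRep? (∈-allFin r) (ar , λ y ay y~r → least (ay , SameN-trans y~r r~x)))
           (∈-class⁺ ax (SameN-sym r~x))

  A-antichain : IsMaximumMatching P M → ∀ {x y} → InA x → InA y → ¬ x ≺ y
  A-antichain ((M⊆C , unique) , maximum) {x} {y} ax ay x≺y =
    ℕ.1+n≰n (maximum ((x , y) ∷ M) (M′⊆C , ((x≢y All.∷ x∉W) ∷ y∉W ∷ unique)))
    where
    M′⊆C : ∀ {e} → e ∈ (x , y) ∷ M → Comparable P (proj₁ e) (proj₂ e)
    M′⊆C (here refl) = inj₁ x≺y
    M′⊆C (there e∈)  = M⊆C e∈
    x≢y : x ≢ y
    x≢y refl = irrefl x x≺y
    x∉W : All (x ≢_) (endpoints P M)
    x∉W = All.tabulate λ { z∈ refl → ax z∈ }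
    y∉W : All (y ≢_) (endpoints P M)
    y∉W = All.tabulate λ { z∈ refl → ay z∈ }

  Chains⇒InA : ∀ {x y} → Chains class reps x y → InA x × InA y
  Chains⇒InA chains with _ , _ , x∈ , y∈ , _ ← find chains =
    proj₁ (∈-class⁻ x∈) , proj₁ (∈-class⁻ y∈)

  ≺′⇒≺∪Chains : _≺′_ ⇒ _≺_ ∪ Chains class reps
  ≺′⇒≺∪Chains {x} {y} x≺′y with inA? x | inA? y
  ... | no _   | no _   = inj₁ x≺′y
  ... | no _   | yes _  = let _ , _ , z~y , x≺z = x≺′y in inj₁ (≺-respʳ-SameN z~y x≺z)
  ... | yes _  | no _   = let _ , _ , z~x , z≺y = x≺′y in inj₁ (≺-respˡ-SameN z~x z≺y)
  ... | yes ax | yes ay = let x~y , x<y = x≺′y in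
    inj₂ (Any.map (λ x∈ → x∈ , ∈-class⁺ ay (SameN-trans (SameN-sym x~y) (proj₂ (∈-class⁻ x∈))) , x<y)
                  (class-of ax))

  ≺∪Chains⇒≺ : ∀ {x y} → ¬ (InA x × InA y) → (_≺_ ∪ Chains class reps) x y → x ≺ y
  ≺∪Chains⇒≺ _      (inj₁ x≺y)   = x≺y
  ≺∪Chains⇒≺ not-AA (inj₂ chains) = ⊥-elim (not-AA (Chains⇒InA chains))

  ≺∪Chains⇒≺′ : IsMaximumMatching P M → _≺_ ∪ Chains class reps ⇒ _≺′_
  ≺∪Chains⇒≺′ maximum {x} {y} x≺y with inA? x | inA? y
  ... | no wx  | no _   = ≺∪Chains⇒≺ (wx ∘ proj₁) x≺y
  ... | no wx  | yes ay = y , ay , SameN-refl y , ≺∪Chains⇒≺ (wx ∘ proj₁) x≺y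
  ... | yes ax | no wy  = x , ax , SameN-refl x , ≺∪Chains⇒≺ (wy ∘ proj₂) x≺y
  ... | yes ax | yes ay with x≺y
  ...   | inj₁ x≺y = ⊥-elim (A-antichain maximum ax ay x≺y)
  ...   | inj₂ chains with r , _ , x∈ , y∈ , x<y ← find chains =
    SameN-trans (proj₂ (∈-class⁻ x∈)) (SameN-sym (proj₂ (∈-class⁻ y∈))) , x<y

lemma4 : ∀ {n : ℕ} (P : Poset n) (M : List (Fin n × Fin n)) →
    IsMaximumMatching P M →
    LE P ≡ Construction.LE′ P M * Construction.prodFact P M
-- prodFact unfolds to the product of (length (class r))! over reps.
lemma4 P M maximum = begin
  LE P
    ≡⟨ LE-chains _≺?_ class reps classes-disjoint (λ _ → class-sorted _) (λ _ → class-Twins _) ⟩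
  LE-rel (_≺_ ∪ Chains class reps) ≺∪Chains? * prodFact
    ≡⟨ cong (_* prodFact) (LE-cong ≺∪Chains? _≺′?_ (≺∪Chains⇒≺′ maximum) ≺′⇒≺∪Chains) ⟩
  LE′ * prodFact
    ∎
  where
  open ≡-Reasoning
  open Poset P
  open Construction P M
  open Classes P M
  ≺∪Chains? : Decidable (_≺_ ∪ Chains class reps)
  ≺∪Chains? = ∪-dec _≺?_ (chains? class reps)
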